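{- Let $G$ be a finite simple cubic graph. If $G$ has a nearly external bisection, then $G$ has an external split $(X,Y)$ with $-2 \le |X| - |Y| \le 2$.
   Context: A split of a graph $G=(V,E)$ is a pair $(X,Y)$ of disjoint sets with $X \sqcup Y = V$; it is a bisection if $|X| = |Y|$. Write $E(X,Y)$ for the set of edges with one end in $X$ and the other in $Y$. A split $(X,Y)$ is external if $H = G - E(X,Y)$ satisfies $\deg_H(v) \le \frac12 \deg_G(v)$ for every $v \in V(G)$. A split $(X,Y)$ is nearly external if there is at most one vertex $v$ with $\deg_G(v) < 2\deg_{G - E(X,Y)}(v)$. -}

module Defs where

open import Data.Nat using (ℕ; _+_; _*_; _≤_; _<_)
open import Data.Bool using (Bool; true; false; _∧_; not; if_then_else_)
open import Data.Fin using (Fin)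
open import Relation.Binary.PropositionalEquality using (_≡_)

record SimpleGraph (n : ℕ) : Set where
  field
    adj       : Fin n → Fin n → Bool
    adj-sym   : ∀ u v → adj u v ≡ adj v u
    adj-irrefl : ∀ v → adj v v ≡ false
open SimpleGraph public

count : ∀ {n} → (Fin n → Bool) → ℕ
count {ℕ.zero} p = 0
count {ℕ.suc n} p = (if p Fin.zero then 1 else 0) + count (λ i → p (Fin.suc i))

deg : ∀ {n} → SimpleGraph n → Fin n → ℕ
deg G v = count (adj G v)

Cubic : ∀ {n} → SimpleGraph n → Set
Cubic G = ∀ v → deg G v ≡ 3

-- A split (X , Y) is encoded by its characteristic function S : X = S⁻¹(true),
-- Y = S⁻¹(false); X and Y are then disjoint and cover V.
Split : ℕ → Set
Split n = Fin n → Bool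

sizeX : ∀ {n} → Split n → ℕ
sizeX S = count S

sizeY : ∀ {n} → Split n → ℕ
sizeY S = count (λ v → not (S v))

sameSide : Bool → Bool → Bool
sameSide true  b = b
sameSide false b = not b

-- degree of v in H = G - E(X,Y): neighbours of v on the same side as v
degH : ∀ {n} → SimpleGraph n → Split n → Fin n → ℕ
degH G S v = count (λ w → adj G v w ∧ sameSide (S v) (S w))

Bisection : ∀ {n} → Split n → Set
Bisection S = sizeX S ≡ sizeY S

External : ∀ {n} → SimpleGraph n → Split n → Set
External G S = ∀ v → 2 * degH G S v ≤ deg G v

Bad : ∀ {n} → SimpleGraph n → Split n → Fin n → Set
Bad G S v = deg G v < 2 * degH G S v

NearlyExternal : ∀ {n} → SimpleGraph n → Split n → Set
NearlyExternal G S = ∀ u w → Bad G S u → Bad G S w → u ≡ w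

{-# OPTIONS --safe #-}
module Submission where

-- Repeatedly move a bad vertex w to the other side.  In a cubic graph a bad w has at
-- least two neighbours on its own side, hence at most one afterwards: w becomes good,
-- the number of edges inside the sides drops, and the only vertex that can become bad
-- is the (at most one) neighbour on the side w joined.  If w always leaves a side that
-- is at least as large as the other, the sizes stay within 2 of each other, and the
-- side w joined is then the larger one, so this property is preserved.

open import Defs
open import Data.Nat using (ℕ; zero; suc; _+_; _*_; _≤_; _<_; z≤n; s≤s; s≤s⁻¹; _≤?_)
open import Data.Product using (Σ; _×_; ∃; _,_; proj₁; proj₂)

open import Algebra.Properties.CommutativeSemigroup using (xy∙z≈zy∙x)
open import Data.Bool using (Bool; true; false; _∧_; not; if_then_else_)
open import Data.Bool.Properties using (not-involutive)
open import Data.Empty using (⊥-elim)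
open import Data.Fin using (Fin; zero; suc; punchIn; _≟_)
open import Data.Fin.Properties using (all?; ¬∀⟶∃¬; punchInᵢ≢i)
open import Data.Nat.Induction using (<-wellFounded)
open import Data.Nat.Properties hiding (_≟_)
open import Data.Sum using (_⊎_; inj₁; inj₂)
open import Data.Vec.Functional using (updateAt; removeAt)
open import Data.Vec.Functional.Properties using (updateAt-updates; updateAt-minimal)
open import Function using (_∘_)
open import Induction.WellFounded using (Acc; acc)
open import Relation.Binary.PropositionalEquality
open import Relation.Nullary using (¬_; yes; no)

open import Algebra.Properties.CommutativeMonoid.Sum +-0-commutativeMonoid
  using (sum; sum-cong-≗; ∑-distrib-+; sum-remove)

indicator : Bool → ℕ
indicator b = if b then 1 else 0

count≡sum : ∀ {n} (p : Fin n → Bool) → count p ≡ sum (indicator ∘ p)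
count≡sum {zero}  p = refl
count≡sum {suc n} p = cong (indicator (p zero) +_) (count≡sum (p ∘ suc))

count-cong : ∀ {n} {p q : Fin n → Bool} → (∀ x → p x ≡ q x) → count p ≡ count q
count-cong {zero}  p≗q = refl
count-cong {suc n} p≗q = cong₂ _+_ (cong indicator (p≗q zero)) (count-cong (p≗q ∘ suc))

sum-swap-at : ∀ {n} (f g : Fin n → ℕ) w → (∀ x → x ≢ w → f x ≡ g x) →
              sum f + g w ≡ sum g + f w
sum-swap-at {suc n} f g w f≗g = begin
  sum f + g w                         ≡⟨ cong (_+ g w) (sum-remove f) ⟩
  f w + sum (removeAt f w) + g w      ≡⟨ cong (λ r → f w + r + g w) rests-agree ⟩
  f w + sum (removeAt g w) + g w      ≡⟨ xy∙z≈zy∙x +-commutativeSemigroup (f w) _ (g w) ⟩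
  g w + sum (removeAt g w) + f w      ≡⟨ cong (_+ f w) (sum-remove g) ⟨
  sum g + f w                         ∎
  where
  open ≡-Reasoning
  rests-agree : sum (removeAt f w) ≡ sum (removeAt g w)
  rests-agree = sum-cong-≗ (λ j → f≗g (punchIn w j) (punchInᵢ≢i w j))

count-swap-at : ∀ {n} (p q : Fin n → Bool) w → (∀ x → x ≢ w → p x ≡ q x) →
                count p + indicator (q w) ≡ count q + indicator (p w)
count-swap-at p q w p≗q = begin
  count p + indicator (q w)             ≡⟨ cong (_+ indicator (q w)) (count≡sum p) ⟩
  sum (indicator ∘ p) + indicator (q w) ≡⟨ sum-swap-at _ _ w (λ x x≢w → cong indicator (p≗q x x≢w)) ⟩
  sum (indicator ∘ q) + indicator (p w) ≡⟨ cong (_+ indicator (p w)) (count≡sum q) ⟨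
  count q + indicator (p w)             ∎
  where open ≡-Reasoning

count-flip : ∀ {n} (p q : Fin n → Bool) w → (∀ x → x ≢ w → p x ≡ q x) →
             p w ≡ true → q w ≡ false → count p ≡ suc (count q)
count-flip p q w p≗q pw qw = begin
  count p                   ≡⟨ +-identityʳ (count p) ⟨
  count p + indicator false ≡⟨ cong (λ b → count p + indicator b) qw ⟨
  count p + indicator (q w) ≡⟨ count-swap-at p q w p≗q ⟩
  count q + indicator (p w) ≡⟨ cong (λ b → count q + indicator b) pw ⟩
  count q + 1               ≡⟨ +-comm (count q) 1 ⟩
  suc (count q)             ∎
  where open ≡-Reasoning

count-∧-split : ∀ {n} (a b : Fin n → Bool) →
                count (λ x → a x ∧ b x) + count (λ x → a x ∧ not (b x)) ≡ count a
count-∧-split {zero}  a b = refl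
count-∧-split {suc n} a b with a zero | b zero | count-∧-split (a ∘ suc) (b ∘ suc)
... | true  | true  | ih = cong suc ih
... | true  | false | ih = trans (+-suc _ _) (cong suc ih)
... | false | _     | ih = ih

count-pos : ∀ {n} (p : Fin n → Bool) x → p x ≡ true → 1 ≤ count p
count-pos p zero    px rewrite px = s≤s z≤n
count-pos p (suc x) px = ≤-trans (count-pos (p ∘ suc) x px) (m≤n+m _ (indicator (p zero)))

count≤1⇒unique : ∀ {n} {p : Fin n → Bool} {x y} → count p ≤ 1 →
                 p x ≡ true → p y ≡ true → x ≡ y
count≤1⇒unique {x = zero} {zero} c px py = refl
count≤1⇒unique {p = p} {zero} {suc y} c px py rewrite px =
  ⊥-elim (≤⇒≯ (s≤s⁻¹ c) (count-pos (p ∘ suc) y py))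
count≤1⇒unique {p = p} {suc x} {zero} c px py rewrite py =
  ⊥-elim (≤⇒≯ (s≤s⁻¹ c) (count-pos (p ∘ suc) x px))
count≤1⇒unique {p = p} {suc x} {suc y} c px py =
  cong suc (count≤1⇒unique (≤-trans (m≤n+m _ (indicator (p zero))) c) px py)

m+n≡o+p⇒p<n⇒m<o : ∀ {m n o p} → m + n ≡ o + p → p < n → m < o
m+n≡o+p⇒p<n⇒m<o {m} {n} {o} {p} eq p<n =
  ≰⇒> (λ o≤m → <-irrefl (sym eq) (+-mono-≤-< o≤m p<n))

3<2*h⇒2≤h : ∀ {h} → 3 < 2 * h → 2 ≤ h
3<2*h⇒2≤h {zero}        ()
3<2*h⇒2≤h {suc zero}    (s≤s (s≤s ()))
3<2*h⇒2≤h {suc (suc h)} _ = s≤s (s≤s z≤n)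

sameSide-refl : ∀ a → sameSide a a ≡ true
sameSide-refl true  = refl
sameSide-refl false = refl

sameSide-not : ∀ a → sameSide a (not a) ≡ false
sameSide-not true  = refl
sameSide-not false = refl

sameSide-comm : ∀ a b → sameSide a b ≡ sameSide b a
sameSide-comm true  true  = refl
sameSide-comm true  false = refl
sameSide-comm false true  = refl
sameSide-comm false false = refl

sameSide-notˡ : ∀ a b → sameSide (not a) b ≡ not (sameSide a b)
sameSide-notˡ true  b = refl
sameSide-notˡ false b = sym (not-involutive b)

sameSide-notʳ : ∀ a b → sameSide a (not b) ≡ not (sameSide a b)
sameSide-notʳ true  b = refl
sameSide-notʳ false b = refl

sameSide≡false⇒opposite : ∀ a b → sameSide a b ≡ false → b ≡ not a
sameSide≡false⇒opposite true  false _ = refl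
sameSide≡false⇒opposite false true  _ = refl

-- sideSize S true and sideSize S false are sizeX S and sizeY S up to definitional unfolding.
sideSize : ∀ {n} → Split n → Bool → ℕ
sideSize S b = count (λ v → sameSide b (S v))

-- Twice the number of edges of G - E(X,Y).
potential : ∀ {n} → SimpleGraph n → Split n → ℕ
potential G S = sum (degH G S)

toggle : ∀ {n} → Split n → Fin n → Split n
toggle S w = updateAt S w not

module Toggle {n} (G : SimpleGraph n) (S : Split n) (w : Fin n) where

  S′ : Split n
  S′ = toggle S w

  toggle-at : S′ w ≡ not (S w)
  toggle-at = updateAt-updates w S

  toggle-elsewhere : ∀ {x} → x ≢ w → S′ x ≡ S x
  toggle-elsewhere {x} = updateAt-minimal x w S

  internal external : Fin n → Bool
  internal x = adj G w x ∧ sameSide (S w) (S x)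
  external x = adj G w x ∧ not (sameSide (S w) (S x))

  internal-self : internal w ≡ false
  internal-self = cong (_∧ _) (adj-irrefl G w)

  external-self : external w ≡ false
  external-self = cong (_∧ _) (adj-irrefl G w)

  external⇒≢ : ∀ {x} → external x ≡ true → x ≢ w
  external⇒≢ ext refl with () ← trans (sym ext) external-self

  external⇒opposite : ∀ {x} → external x ≡ true → S x ≡ not (S w)
  external⇒opposite {x} ext with adj G w x | sameSide (S w) (S x) in same
  ... | true | false = sameSide≡false⇒opposite (S w) (S x) same

  degH-toggled : degH G S′ w ≡ count external
  degH-toggled = count-cong pointwise
    where
    pointwise : ∀ y → adj G w y ∧ sameSide (S′ w) (S′ y) ≡ external y
    pointwise y with y ≟ w
    ... | yes refl = trans (cong (_∧ _) (adj-irrefl G w)) (sym external-self)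
    ... | no y≢w = cong (adj G w y ∧_) (begin
      sameSide (S′ w) (S′ y)     ≡⟨ cong₂ sameSide toggle-at (toggle-elsewhere y≢w) ⟩
      sameSide (not (S w)) (S y) ≡⟨ sameSide-notˡ (S w) (S y) ⟩
      not (sameSide (S w) (S y)) ∎)
      where open ≡-Reasoning

  degH-toggle-sum : degH G S w + degH G S′ w ≡ deg G w
  degH-toggle-sum = trans (cong (degH G S w +_) degH-toggled)
                          (count-∧-split (adj G w) (λ y → sameSide (S w) (S y)))

  degH-elsewhere : ∀ {x} → x ≢ w →
                   degH G S′ x + indicator (internal x) ≡ degH G S x + indicator (external x)
  degH-elsewhere {x} x≢w = begin
    degH G S′ x + indicator (internal x)   ≡⟨ cong (_+ indicator (internal x)) (count-cong own-side) ⟩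
    count p + indicator (internal x)       ≡⟨ cong (λ b → count p + indicator b) seen-from-w ⟨
    count p + indicator (q w)              ≡⟨ count-swap-at p q w agree-off-w ⟩
    count q + indicator (p w)              ≡⟨ cong (λ b → degH G S x + indicator b) toggled-seen-from-w ⟩
    degH G S x + indicator (external x)    ∎
    where
    open ≡-Reasoning
    p q : Fin n → Bool
    p y = adj G x y ∧ sameSide (S x) (S′ y)
    q y = adj G x y ∧ sameSide (S x) (S y)
    agree-off-w : ∀ y → y ≢ w → p y ≡ q y
    agree-off-w y y≢w = cong (λ b → adj G x y ∧ sameSide (S x) b) (toggle-elsewhere y≢w)
    own-side : ∀ y → adj G x y ∧ sameSide (S′ x) (S′ y) ≡ p y
    own-side y = cong (λ b → adj G x y ∧ sameSide b (S′ y)) (toggle-elsewhere x≢w)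
    seen-from-w : q w ≡ internal x
    seen-from-w = cong₂ _∧_ (adj-sym G x w) (sameSide-comm (S x) (S w))
    toggled-seen-from-w : p w ≡ external x
    toggled-seen-from-w = begin
      adj G x w ∧ sameSide (S x) (S′ w)          ≡⟨ cong (λ b → adj G x w ∧ sameSide (S x) b) toggle-at ⟩
      adj G x w ∧ sameSide (S x) (not (S w))     ≡⟨ cong (adj G x w ∧_) (sameSide-notʳ (S x) (S w)) ⟩
      adj G x w ∧ not (sameSide (S x) (S w))     ≡⟨ cong (λ b → b ∧ _) (adj-sym G x w) ⟩
      adj G w x ∧ not (sameSide (S x) (S w))     ≡⟨ cong (λ b → adj G w x ∧ not b) (sameSide-comm (S x) (S w)) ⟩
      external x                                 ∎

  degH-toggle-≤ : ∀ {x} → x ≢ w → external x ≡ false → degH G S′ x ≤ degH G S x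
  degH-toggle-≤ {x} x≢w ext = begin
    degH G S′ x                             ≤⟨ m≤m+n _ _ ⟩
    degH G S′ x + indicator (internal x)    ≡⟨ degH-elsewhere x≢w ⟩
    degH G S x + indicator (external x)     ≡⟨ cong (λ b → degH G S x + indicator b) ext ⟩
    degH G S x + 0                          ≡⟨ +-identityʳ _ ⟩
    degH G S x                              ∎
    where open ≤-Reasoning

  potential-toggle : potential G S′ + 2 * degH G S w ≡ potential G S + 2 * degH G S′ w
  potential-toggle = begin
    potential G S′ + 2 * h                ≡⟨ +-assoc (potential G S′) h (h + 0) ⟨
    potential G S′ + h + (h + 0)          ≡⟨ cong₂ (λ a b → a + (h + indicator b)) sum-f external-self ⟨
    sum f + g w                           ≡⟨ sum-swap-at f g w (λ x → degH-elsewhere) ⟩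
    sum g + f w                           ≡⟨ cong₂ (λ a b → a + (h′ + indicator b)) sum-g internal-self ⟩
    potential G S + h′ + (h′ + 0)         ≡⟨ +-assoc (potential G S) h′ (h′ + 0) ⟩
    potential G S + 2 * h′                ∎
    where
    open ≡-Reasoning
    h h′ : ℕ
    h = degH G S w
    h′ = degH G S′ w
    f g : Fin n → ℕ
    f x = degH G S′ x + indicator (internal x)
    g x = degH G S x + indicator (external x)
    sum-f : sum f ≡ potential G S′ + h
    sum-f = trans (∑-distrib-+ (degH G S′) _) (cong (potential G S′ +_) (sym (count≡sum internal)))
    sum-g : sum g ≡ potential G S + h′
    sum-g = trans (∑-distrib-+ (degH G S) _)
                  (cong (potential G S +_) (trans (sym (count≡sum external)) (sym degH-toggled)))

  sideSize-own : sideSize S (S w) ≡ suc (sideSize S′ (S w))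
  sideSize-own = count-flip _ _ w (λ x x≢w → cong (sameSide (S w)) (sym (toggle-elsewhere x≢w)))
    (sameSide-refl (S w)) (trans (cong (sameSide (S w)) toggle-at) (sameSide-not (S w)))

  sideSize-other : sideSize S′ (not (S w)) ≡ suc (sideSize S (not (S w)))
  sideSize-other = count-flip _ _ w (λ x x≢w → cong (sameSide (not (S w))) (toggle-elsewhere x≢w))
    (trans (cong (sameSide (not (S w))) toggle-at) (sameSide-refl (not (S w))))
    (trans (sameSide-comm (not (S w)) (S w)) (sameSide-not (S w)))

record Invariant {n} (G : SimpleGraph n) (S : Split n) : Set where
  field
    nearlyExternal  : NearlyExternal G S
    balanced        : ∀ b → sideSize S b ≤ sideSize S (not b) + 2
    badOnLargerSide : ∀ v → Bad G S v → sideSize S (not (S v)) ≤ sideSize S (S v)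

bisection-invariant : ∀ {n} {G : SimpleGraph n} {S : Split n} →
                      Bisection S → NearlyExternal G S → Invariant G S
bisection-invariant {S = S} bisection nearlyExternal = record
  { nearlyExternal  = nearlyExternal
  ; balanced        = λ b → ≤-trans (≤-reflexive (sides-equal b)) (m≤m+n _ 2)
  ; badOnLargerSide = λ v _ → ≤-reflexive (sym (sides-equal (S v)))
  }
  where
  sides-equal : ∀ b → sideSize S b ≡ sideSize S (not b)
  sides-equal true  = bisection
  sides-equal false = sym bisection

balanced-from : ∀ {n} (S : Split n) a →
                sideSize S a ≤ sideSize S (not a) + 2 → sideSize S (not a) ≤ sideSize S a + 2 →
                ∀ b → sideSize S b ≤ sideSize S (not b) + 2
balanced-from S true  own other true  = own
balanced-from S true  own other false = other
balanced-from S false own other true  = other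
balanced-from S false own other false = own

move-one : ∀ {x x′ y y′} → x ≡ suc x′ → y′ ≡ suc y → y ≤ x → x ≤ y + 2 → x′ ≤ y′ × y′ ≤ x′ + 2
move-one {x′ = x′} {y} refl refl y≤x x≤y+2 =
  s≤s⁻¹ (≤-trans x≤y+2 (≤-reflexive (+-comm y 2))) , ≤-trans (s≤s y≤x) (≤-reflexive (+-comm 2 x′))

module CubicToggle {n} (G : SimpleGraph n) (cubic : Cubic G)
                   (S : Split n) {w : Fin n} (bad : Bad G S w) where

  open Toggle G S w

  degH-sum≡3 : degH G S w + degH G S′ w ≡ 3
  degH-sum≡3 = trans degH-toggle-sum (cubic w)

  2≤degH : 2 ≤ degH G S w
  2≤degH = 3<2*h⇒2≤h (subst (_< 2 * degH G S w) (cubic w) bad)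

  toggled-degH≤1 : degH G S′ w ≤ 1
  toggled-degH≤1 = +-cancelˡ-≤ 2 _ _
    (≤-trans (+-monoˡ-≤ (degH G S′ w) 2≤degH) (≤-reflexive degH-sum≡3))

  toggled-good : ¬ Bad G S′ w
  toggled-good bad′ = <⇒≱ (subst (_< 2 * degH G S′ w) (cubic w) bad′)
                          (≤-trans (*-monoʳ-≤ 2 toggled-degH≤1) (n≤1+n 2))

  potential-decreases : potential G S′ < potential G S
  potential-decreases = m+n≡o+p⇒p<n⇒m<o potential-toggle
    (*-monoʳ-< 2 (≤-trans (s≤s toggled-degH≤1) 2≤degH))

  module _ (nearlyExternal : NearlyExternal G S) where

    bad-after⇒external : ∀ {x} → Bad G S′ x → external x ≡ true
    bad-after⇒external {x} bad′ with x ≟ w | external x in ext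
    ... | yes refl | _     = ⊥-elim (toggled-good bad′)
    ... | no x≢w   | true  = refl
    ... | no x≢w   | false =
      ⊥-elim (x≢w (nearlyExternal x w (<-≤-trans bad′ (*-monoʳ-≤ 2 (degH-toggle-≤ x≢w ext))) bad))

    nearlyExternal-after : NearlyExternal G S′
    nearlyExternal-after u v bad-u bad-v =
      count≤1⇒unique (subst (_≤ 1) degH-toggled toggled-degH≤1)
        (bad-after⇒external bad-u) (bad-after⇒external bad-v)

    bad-after-side : ∀ {x} → Bad G S′ x → S′ x ≡ not (S w)
    bad-after-side bad′ = trans (toggle-elsewhere (external⇒≢ ext)) (external⇒opposite ext)
      where ext = bad-after⇒external bad′

  toggle-invariant : Invariant G S → Invariant G S′
  toggle-invariant inv = record
    { nearlyExternal  = nearlyExternal-after nearlyExternal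
    ; balanced        = balanced-from S′ (S w) (≤-trans own≤other (m≤m+n _ 2)) other≤own+2
    ; badOnLargerSide = λ x bad′ → on-larger-side (bad-after-side nearlyExternal bad′)
    }
    where
    open Invariant inv
    moved = move-one sideSize-own sideSize-other (badOnLargerSide w bad) (balanced (S w))
    own≤other = proj₁ moved
    other≤own+2 = proj₂ moved
    on-larger-side : ∀ {c} → c ≡ not (S w) → sideSize S′ (not c) ≤ sideSize S′ c
    on-larger-side refl rewrite not-involutive (S w) = own≤other

external-or-bad : ∀ {n} (G : SimpleGraph n) (S : Split n) → External G S ⊎ ∃ (Bad G S)
external-or-bad {n} G S with all? (λ v → 2 * degH G S v ≤? deg G v)
... | yes external = inj₁ external
... | no ¬external with v , v-not-good ← ¬∀⟶∃¬ n _ (λ v → 2 * degH G S v ≤? deg G v) ¬external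
  = inj₂ (v , ≰⇒> v-not-good)

module _ {n} (G : SimpleGraph n) (cubic : Cubic G) where

  search : ∀ S → Acc _<_ (potential G S) → Invariant G S →
           Σ (Split n) λ T → External G T × (sizeX T ≤ sizeY T + 2) × (sizeY T ≤ sizeX T + 2)
  search S (acc smaller) inv with external-or-bad G S
  ... | inj₁ external = S , external , balanced true , balanced false
    where open Invariant inv
  ... | inj₂ (w , bad) = search (toggle S w) (smaller potential-decreases) (toggle-invariant inv)
    where open CubicToggle G cubic S bad

lemma2p1 : ∀ {n} (G : SimpleGraph n) → Cubic G →
    (Σ (Split n) λ S → Bisection S × NearlyExternal G S) →
    Σ (Split n) λ S → External G S × (sizeX S ≤ sizeY S + 2) × (sizeY S ≤ sizeX S + 2)
lemma2p1 G cubic (S , bisection , nearlyExternal) =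
  search G cubic S (<-wellFounded (potential G S)) (bisection-invariant bisection nearlyExternal)
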